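{- Let $U$ be an ultrafilter on $\omega$ and $\lambda\le\mathfrak{c}$ a cardinal, and suppose $\diamondsuit^-_\lambda(U)$ holds. Then there is a sequence $\langle A_\alpha\mid\alpha<\lambda\rangle$ of elements of $U$ such that for every infinite $I\subseteq\lambda$ (indeed every countably infinite $I$), $\bigcap_{i\in I}A_i\notin U$. In particular $[\lambda]^{<\omega}\le_T U$.
   Context: For a filter $F$ on $\omega$, $A$ is $F$-positive if it meets every member of $F$. For $\pi,f:\omega\to\omega$ and $T\subseteq\mathcal{P}(\omega)$, $\diamondsuit^-(U,\pi,f,T)$ means: there is $\langle\mathcal{A}_n\mid n<\omega\rangle$ with $\mathcal{A}_n\subseteq\mathcal{P}(f(n))$ (where $f(n)=\{0,\dots,f(n)-1\}$) and $|\mathcal{A}_n|\le\pi(n)$, such that for every $X\in T$, $\{n\mid X\cap f(n)\in\mathcal{A}_n\}$ is $U$-positive. We write $sky([\pi]_U)<sky([f]_U)$ if for every $h:\omega\to\omega$, $\{n<\omega\mid h(\pi(n))<f(n)\}\in U$. $\diamondsuit^-_\lambda(U)$ means: there are $\pi,f:\omega\to\omega$ and $T\subseteq\mathcal{P}(\omega)$ with $sky([\pi]_U)<sky([f]_U)$, $|T|=\lambda$, and $\diamondsuit^-(U,\pi,f,T)$. Tukey order: for directed sets $(D,\le_D)$, $(E,\le_E)$, $D\le_T E$ iff there is a map $g:D\to E$ sending unbounded subsets of $D$ to unbounded subsets of $E$; $[\lambda]^{<\omega}$ is ordered by $\subseteq$ and $U$ by reverse inclusion $\supseteq$. -}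

module Defs where

open import Level using (0ℓ)
open import Data.Nat using (ℕ; _<_; _≤_)
open import Data.Fin using (Fin; toℕ)
open import Data.List using (List; length)
open import Data.List.Relation.Unary.Any using (Any)
open import Data.List.Membership.Propositional using (_∈_)
open import Data.Product using (Σ; ∃; _×_; proj₁)
open import Data.Sum using (_⊎_)
open import Data.Unit using (⊤)
open import Data.Empty using (⊥)
open import Function.Bundles using (_⇔_)
open import Relation.Nullary using (¬_)
open import Relation.Unary using (Pred; _⊆_; _∩_; ∁)
open import Relation.Binary.PropositionalEquality using (_≡_)

Subset : Set₁
Subset = Pred ℕ 0ℓ

_≐_ : Subset → Subset → Set
X ≐ Y = ∀ n → X n ⇔ Y n

record IsUltrafilter (U : Pred Subset 0ℓ) : Set₁ where
  field
    full     : U (λ _ → ⊤)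
    proper   : ¬ U (λ _ → ⊥)
    upward   : ∀ {A B : Subset} → A ⊆ B → U A → U B
    meet     : ∀ {A B : Subset} → U A → U B → U (A ∩ B)
    ultra    : ∀ (A : Subset) → U A ⊎ U (∁ A)

-- A is U-positive: it meets every member of U.
-- (A is allowed to be a large predicate, since traces live in Set₁.)
Positive : Pred Subset 0ℓ → (ℕ → Set₁) → Set₁
Positive U A = ∀ (B : Subset) → U B → ∃ λ n → A n × B n

-- sky([π]_U) < sky([f]_U)
SkyLess : Pred Subset 0ℓ → (ℕ → ℕ) → (ℕ → ℕ) → Set
SkyLess U π f = ∀ (h : ℕ → ℕ) → U (λ n → h (π n) < f n)

-- X ∩ f(n) ∈ 𝒜, where 𝒜 ⊆ P(f(n)) is given by a finite list of subsets
-- of f(n) = {0,…,f(n)-1} (identified with Fin (f n)), compared extensionally.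
TraceIn : (m : ℕ) → List (Pred (Fin m) 0ℓ) → Subset → Set₁
TraceIn m 𝒜 X = Any (λ S → ∀ (i : Fin m) → S i ⇔ X (toℕ i)) 𝒜

-- ◇⁻(U, π, f, T), with T given as a family of subsets indexed by L.
DiamondMinus : Pred Subset 0ℓ → (ℕ → ℕ) → (ℕ → ℕ) → {L : Set} → (L → Subset) → Set₁
DiamondMinus U π f {L} T =
  Σ ((n : ℕ) → List (Pred (Fin (f n)) 0ℓ)) λ 𝒜 →
    ((n : ℕ) → length (𝒜 n) ≤ π n) ×
    (∀ (X : L) → Positive U (λ n → TraceIn (f n) (𝒜 n) (T X)))

-- T : L → P(ω) is injective (so its image has cardinality |L|).
InjectiveSubsets : {L : Set} → (L → Subset) → Set
InjectiveSubsets {L} T = ∀ (a b : L) → T a ≐ T b → a ≡ b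

-- ◇⁻_λ(U), with the cardinal λ represented by a type L.
DiamondMinusλ : Pred Subset 0ℓ → Set → Set₁
DiamondMinusλ U L =
  Σ (ℕ → ℕ) λ π → Σ (ℕ → ℕ) λ f → Σ (L → Subset) λ T →
    SkyLess U π f × InjectiveSubsets T × DiamondMinus U π f T

⋂ : (ℕ → Subset) → Subset
⋂ B n = ∀ k → B k n

InjectiveSeq : {L : Set} → (ℕ → L) → Set
InjectiveSeq {L} i = ∀ (j k : ℕ) → i j ≡ i k → j ≡ k

-- [L]^{<ω}: finite subsets as lists, ordered by inclusion.
_⊑_ : {L : Set} → List L → List L → Set
xs ⊑ ys = ∀ {a} → a ∈ xs → a ∈ ys

UnboundedFin : {L : Set} → Pred (List L) 0ℓ → Set
UnboundedFin {L} 𝒳 = ¬ (Σ (List L) λ ub → ∀ xs → 𝒳 xs → xs ⊑ ub)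

-- U as a directed set under reverse inclusion.
UElem : Pred Subset 0ℓ → Set₁
UElem U = Σ Subset U

-- [L]^{<ω} ≤_T (U, ⊇): some map sends unbounded sets to unbounded sets
-- (unboundedness of the image {g x | x ∈ 𝒳} in (U, ⊇): no C ∈ U below all).
TukeyFinLeU : Set → Pred Subset 0ℓ → Set₁
TukeyFinLeU L U =
  Σ (List L → UElem U) λ g →
    ∀ (𝒳 : Pred (List L) 0ℓ) → UnboundedFin 𝒳 →
      ¬ (Σ Subset λ C → U C × (∀ xs → 𝒳 xs → C ⊆ proj₁ (g xs)))

-- Let 𝒜ₙ be the guessing lists and put A α = {n | X_α ∩ f(n) ∈ 𝒜ₙ}; A α ∈ U because
-- the set of good guesses for X_α is U-positive. Distinct X_α, X_β agree below f(n)
-- only for U-few n, since f is unbounded modulo U. So for any m and any m distinct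
-- indices there is a point n₀ where their traces below f(n₀) are pairwise distinct;
-- call h(m) that f(n₀). If C ∈ U lay below A α for infinitely many α, pick n ∈ C
-- with h(π n + 1) < f(n): then π n + 1 distinct sets all have their traces below
-- f(n) among the at most π n members of 𝒜ₙ, so two of them agree below f(n), hence
-- below f(n₀), contradicting the choice of n₀. The Tukey map sends a finite set s to
-- ⋂_{α∈s} A α: an unbounded family of finite sets mentions infinitely many indices.
module Submission where

open import Defs
open import Data.Nat using (ℕ)
open import Data.Product using (Σ; _×_)
open import Relation.Nullary using (¬_)

open import Level using (0ℓ)
open import Data.Nat using (zero; suc; _<_; _≤_; s≤s)
open import Data.Nat.Properties using (<-trans)
open import Data.Fin as Fin using (Fin; toℕ; fromℕ<)
open import Data.Fin.Properties using (pigeonhole; toℕ-fromℕ<; toℕ-injective; <⇒≢; _≟_)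
open import Data.Vec.Functional as Vector using (Vector)
open import Data.List using (List; []; _∷_; length; lookup; tabulate)
open import Data.List.Relation.Unary.Any using (here; there; index)
open import Data.List.Relation.Unary.Any.Properties using (lookup-index)
open import Data.List.Membership.Propositional using (_∈_)
open import Data.List.Membership.Propositional.Properties using (∈-tabulate⁺)
open import Data.Product using (∃; ∃₂; _,_; proj₁)
open import Data.Sum using (_⊎_; inj₁; inj₂)
open import Data.Empty using (⊥-elim)
open import Function.Base using (_∘_)
open import Function.Bundles using (_⇔_)
open import Function.Definitions using (Injective)
open import Function.Construct.Identity using (⇔-id)
open import Function.Construct.Symmetry using (⇔-sym)
open import Function.Construct.Composition using (_⇔-∘_)
open import Relation.Nullary using (Stable; yes; no)
open import Relation.Unary using (Pred; _⊆_; ∁)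
open import Relation.Binary.PropositionalEquality using (_≡_; _≢_; refl; sym; cong; subst)

TraceIndex : (m : ℕ) → List (Pred (Fin m) 0ℓ) → Subset → Set
TraceIndex m 𝒜 X = Σ (Fin (length 𝒜)) λ j → ∀ i → lookup 𝒜 j i ⇔ X (toℕ i)

traceIn⇒traceIndex : ∀ {m 𝒜 X} → TraceIn m 𝒜 X → TraceIndex m 𝒜 X
traceIn⇒traceIndex p = index p , lookup-index p

InjectiveTuple : {L : Set} → (L → Set) → ℕ → Set
InjectiveTuple {L} Src m =
  Σ (Vector L m) λ v → Injective _≡_ _≡_ v × (∀ i → Src (v i))

-- A constructive stand-in for "Src is infinite".
¬¬Infinite : {L : Set} → (L → Set) → Set
¬¬Infinite Src = ∀ m → ¬ ¬ InjectiveTuple Src m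

∷-injective : ∀ {L : Set} {m} {a : L} {v : Vector L m} →
  (∀ i → v i ≢ a) → Injective _≡_ _≡_ v → Injective _≡_ _≡_ (a Vector.∷ v)
∷-injective a∉v v-inj {Fin.zero}  {Fin.zero}  eq = refl
∷-injective a∉v v-inj {Fin.zero}  {Fin.suc j} eq = ⊥-elim (a∉v j (sym eq))
∷-injective a∉v v-inj {Fin.suc i} {Fin.zero}  eq = ⊥-elim (a∉v i eq)
∷-injective a∉v v-inj {Fin.suc i} {Fin.suc j} eq = cong Fin.suc (v-inj eq)

∈-stable : {L : Set} → (∀ (P : Set) → ¬ ¬ P ⊎ ¬ P) → (∀ (a b : L) → Stable (a ≡ b)) →
  ∀ (a : L) xs → Stable (a ∈ xs)
∈-stable wlem ≡-stable a []       ¬¬a∈ = ⊥-elim (¬¬a∈ λ ())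
∈-stable wlem ≡-stable a (b ∷ xs) ¬¬a∈ with wlem (a ≡ b)
... | inj₁ ¬¬a≡b = here (≡-stable a b ¬¬a≡b)
... | inj₂ a≢b   = there (∈-stable wlem ≡-stable a xs λ a∉xs →
                     ¬¬a∈ λ { (here a≡b) → a≢b a≡b ; (there a∈xs) → a∉xs a∈xs })

Mentioned : {L : Set} → Pred (List L) 0ℓ → L → Set
Mentioned {L} 𝒳 α = ∃ λ (xs : List L) → 𝒳 xs × α ∈ xs

Range : {L : Set} → (ℕ → L) → L → Set
Range i α = ∃ λ k → i k ≡ α

injectiveSeq⇒¬¬Infinite : {L : Set} {i : ℕ → L} → InjectiveSeq i → ¬¬Infinite (Range i)
injectiveSeq⇒¬¬Infinite {i = i} i-inj m ¬tuple =
  ¬tuple (i ∘ toℕ , toℕ-injective ∘ i-inj _ _ , λ k → toℕ k , refl)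

-- If m mentioned indices cannot be extended, their list bounds 𝒳.
unbounded⇒¬¬Infinite : {L : Set} {𝒳 : Pred (List L) 0ℓ} →
  (∀ (a : L) xs → Stable (a ∈ xs)) → UnboundedFin 𝒳 → ¬¬Infinite (Mentioned 𝒳)
unbounded⇒¬¬Infinite ∈-stable unbounded zero    ¬tuple = ¬tuple ((λ ()) , (λ { {()} }) , λ ())
unbounded⇒¬¬Infinite ∈-stable unbounded (suc m) ¬tuple =
  unbounded⇒¬¬Infinite ∈-stable unbounded m λ (v , v-inj , v-src) →
    unbounded (tabulate v , λ xs xs∈𝒳 {a} a∈xs → ∈-stable a (tabulate v) λ a∉v →
      ¬tuple ( a Vector.∷ v
             , ∷-injective (λ i vi≡a → a∉v (subst (_∈ tabulate v) vi≡a (∈-tabulate⁺ i))) v-inj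
             , λ { Fin.zero → xs , xs∈𝒳 , a∈xs ; (Fin.suc i) → v-src i }))

module UltrafilterProperties {U : Subset → Set} (isU : IsUltrafilter U) where
  open IsUltrafilter isU

  weak-excluded-middle : (P : Set) → ¬ ¬ P ⊎ ¬ P
  weak-excluded-middle P with ultra (λ _ → P)
  ... | inj₁ U-P  = inj₁ λ ¬p → proper (upward (λ p → ¬p p) U-P)
  ... | inj₂ U-¬P = inj₂ λ p → proper (upward (λ ¬p → ¬p p) U-¬P)

  ⋂-Fin : ∀ {k} (S : Fin k → Subset) → (∀ i → U (S i)) → U (λ n → ∀ i → S i n)
  ⋂-Fin {zero}  S U-S = upward (λ _ ()) full
  ⋂-Fin {suc k} S U-S =
    upward (λ { (p , q) → λ { Fin.zero → p ; (Fin.suc i) → q i } })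
      (meet (U-S Fin.zero) (⋂-Fin (S ∘ Fin.suc) (U-S ∘ Fin.suc)))

  ⋂-List : {L : Set} (S : L → Subset) → (∀ α → U (S α)) →
    ∀ xs → U (λ n → ∀ α → α ∈ xs → S α n)
  ⋂-List S U-S []       = upward (λ _ _ ()) full
  ⋂-List S U-S (x ∷ xs) =
    upward (λ { (p , q) α (here refl) → p ; (p , q) α (there α∈xs) → q α α∈xs })
      (meet (U-S x) (⋂-List S U-S xs))

module Guessing {U : Subset → Set} (isU : IsUltrafilter U) {L : Set}
  {π f : ℕ → ℕ} {T : L → Subset} (sky : SkyLess U π f) (T-inj : InjectiveSubsets T)
  {𝒜 : (n : ℕ) → List (Pred (Fin (f n)) 0ℓ)} (𝒜-small : ∀ n → length (𝒜 n) ≤ π n)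
  (guesses : ∀ α → Positive U (λ n → TraceIn (f n) (𝒜 n) (T α))) where

  open IsUltrafilter isU
  open UltrafilterProperties isU

  U-inhabited : L → ∀ {B} → U B → ∃ B
  U-inhabited α {B} U-B with guesses α B U-B
  ... | n , _ , Bn = n , Bn

  Guessed : L → Subset
  Guessed α n = TraceIndex (f n) (𝒜 n) (T α)

  U-Guessed : ∀ α → U (Guessed α)
  U-Guessed α with ultra (Guessed α)
  ... | inj₁ U-G  = U-G
  ... | inj₂ U-∁G with guesses α (∁ (Guessed α)) U-∁G
  ...   | n , guessed , not-guessed =
    ⊥-elim (not-guessed (traceIn⇒traceIndex {f n} {𝒜 n} {T α} guessed))

  Agree : L → L → Subset
  Agree α β n = ∀ t → t < f n → T α t ⇔ T β t

  U-Agree⇒≡ : ∀ {α β} → U (Agree α β) → α ≡ β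
  U-Agree⇒≡ {α} {β} U-agree = T-inj α β λ t →
    let (_ , agree , t<fn) = U-inhabited α (meet U-agree (sky (λ _ → t)))
    in agree t t<fn

  ≡-stable : ∀ α β → Stable (α ≡ β)
  ≡-stable α β ¬¬α≡β with ultra (Agree α β)
  ... | inj₁ U-agree = U-Agree⇒≡ U-agree
  ... | inj₂ U-disagree =
    let (_ , disagree) = U-inhabited α U-disagree
    in ⊥-elim (¬¬α≡β λ { refl → disagree λ _ _ → ⇔-id _ })

  U-∁Agree : ∀ {α β} → α ≢ β → U (∁ (Agree α β))
  U-∁Agree {α} {β} α≢β with ultra (Agree α β)
  ... | inj₁ U-agree    = ⊥-elim (α≢β (U-Agree⇒≡ U-agree))
  ... | inj₂ U-disagree = U-disagree

  Separated : ∀ {m} → Vector L m → Subset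
  Separated v n = ∀ i j → i ≢ j → ¬ Agree (v i) (v j) n

  U-Separated : ∀ {m} (v : Vector L m) → Injective _≡_ _≡_ v → U (Separated v)
  U-Separated v v-inj = ⋂-Fin _ λ i → ⋂-Fin _ λ j → pair i j
    where
    pair : ∀ i j → U (λ n → i ≢ j → ¬ Agree (v i) (v j) n)
    pair i j with i ≟ j
    ... | yes refl = upward (λ _ i≢i → ⊥-elim (i≢i refl)) full
    ... | no i≢j   = upward (λ disagree _ → disagree) (U-∁Agree (i≢j ∘ v-inj))

  sameGuess⇒Agree : ∀ {α β n} (gα : Guessed α n) (gβ : Guessed β n) →
    proj₁ gα ≡ proj₁ gβ → Agree α β n
  sameGuess⇒Agree {α} {β} {n} (j , αj) (.j , βj) refl t t<fn =
    subst (λ s → T α s ⇔ T β s) (toℕ-fromℕ< t<fn) (βj i ⇔-∘ ⇔-sym (αj i))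
    where i = fromℕ< t<fn

  guessed-tuple-agrees : ∀ {n} (v : Vector L (suc (π n))) → (∀ i → Guessed (v i) n) →
    ∃₂ λ i j → i ≢ j × Agree (v i) (v j) n
  guessed-tuple-agrees {n} v guessed =
    let (i , j , i<j , same) = pigeonhole (s≤s (𝒜-small n)) (proj₁ ∘ guessed)
    in i , j , <⇒≢ i<j , sameGuess⇒Agree (guessed i) (guessed j) same

  SeparatedTuple : (L → Set) → ℕ → Subset
  SeparatedTuple Src m n = ¬ ¬ Σ (InjectiveTuple Src m) λ (v , _) → Separated v n

  U-SeparatedTuple : ∀ Src → L → ¬¬Infinite Src → ∀ m → U (SeparatedTuple Src m)
  U-SeparatedTuple Src α₀ infinite m with ultra (SeparatedTuple Src m)
  ... | inj₁ U-S  = U-S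
  ... | inj₂ U-∁S = ⊥-elim (infinite m λ tuple@(v , v-inj , _) →
    let (_ , ¬separated , separated) = U-inhabited α₀ (meet U-∁S (U-Separated v v-inj))
    in ¬separated λ ¬tuple → ¬tuple (tuple , separated))

  no-U-lower-bound : ∀ Src {C} → L → ¬¬Infinite Src → U C → ¬ (∀ α → Src α → C ⊆ Guessed α)
  no-U-lower-bound Src α₀ infinite U-C below =
    let (n , Cn , h<fn) = U-inhabited α₀ (meet U-C (sky h))
        (n₀ , separated-at-n₀) = separatedPoint (suc (π n))
    in separated-at-n₀ λ ((v , _ , src) , separated) →
      let (i , j , i≢j , agree) = guessed-tuple-agrees v (λ i → below (v i) (src i) Cn)
      in separated i j i≢j λ t t<fn₀ → agree t (<-trans t<fn₀ h<fn)
    where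
    separatedPoint : ∀ m → ∃ (SeparatedTuple Src m)
    separatedPoint m = U-inhabited α₀ (U-SeparatedTuple Src α₀ infinite m)

    h : ℕ → ℕ
    h m = f (proj₁ (separatedPoint (suc m)))

  ⋂-Guessed∉U : ∀ i → InjectiveSeq i → ¬ U (⋂ (Guessed ∘ i))
  ⋂-Guessed∉U i i-inj U-⋂ =
    no-U-lower-bound (Range i) (i 0) (injectiveSeq⇒¬¬Infinite i-inj) U-⋂
      λ { α (k , refl) ⋂n → ⋂n k }

  [L]<ω≤ᵀU : TukeyFinLeU L U
  [L]<ω≤ᵀU = (λ xs → _ , ⋂-List Guessed U-Guessed xs) , λ 𝒳 unbounded (C , U-C , below) →
    let infinite = unbounded⇒¬¬Infinite (∈-stable weak-excluded-middle ≡-stable) unbounded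
        -- no-U-lower-bound needs some index α₀, so [] must bound 𝒳
        nothing-mentioned : ∀ α → ¬ Mentioned 𝒳 α
        nothing-mentioned α _ = no-U-lower-bound (Mentioned 𝒳) α infinite U-C
          λ β (ys , ys∈𝒳 , β∈ys) Cn → below ys ys∈𝒳 Cn β β∈ys
    in unbounded ([] , λ xs xs∈𝒳 {α} α∈xs → ⊥-elim (nothing-mentioned α (xs , xs∈𝒳 , α∈xs)))

mainTheorem4 : (U : Subset → Set) → IsUltrafilter U → (L : Set) →
    DiamondMinusλ U L →
    Σ (L → Subset) (λ A → ((α : L) → U (A α)) ×
      ((i : ℕ → L) → InjectiveSeq i → ¬ U (⋂ (λ k → A (i k)))))
    × TukeyFinLeU L U
mainTheorem4 U isU L (π , f , T , sky , T-inj , 𝒜 , 𝒜-small , guesses) =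
  (Guessed , U-Guessed , ⋂-Guessed∉U) , [L]<ω≤ᵀU
  where open Guessing isU sky T-inj 𝒜-small guesses
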